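{- Let $G=(V,E)$ be a finite simple graph with maximal degree $\Delta$ and with $k$ separation vertices. Then there exists a graph $H$ on $|V|$ vertices which is a disjoint union $H=G_-\cup G_\Delta$ of two graphs (no edges between $G_-$ and $G_\Delta$) such that: (1) every vertex of $G_\Delta$ with degree (in $G_\Delta$) less than $\Delta$ is a separation vertex of $G_\Delta$; (2) $G_\Delta$ has at most $k$ separation vertices; (3) every vertex of $G_-$ has degree strictly less than $\Delta$; (4) $G_-$ has at most $k(\Delta-1)$ separation vertices; (5) $d(G,H)\le k(\Delta-2)$.
   Context: A vertex $v$ of a graph is a separation vertex if it has a neighbor $w$ with $\deg(w)>\deg(v)$. For two graphs $G,H$ on the same number $n$ of vertices, $d(G,H)=\frac12\min_{\pi\in S_n}\sum_{i,j=1}^n |A(G)_{i,j}-A(H)_{\pi(i),\pi(j)}|$, where $A(\cdot)$ is the adjacency matrix; equivalently, the minimal number of edge additions/removals turning $G$ into a graph isomorphic to $H$. -}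

module Defs where

open import Data.Bool using (Bool; true; false; _∧_; _xor_; if_then_else_)
open import Data.Nat using (ℕ; zero; suc; _+_; _<ᵇ_; _⊔_; _/_)
open import Data.Fin using (Fin; splitAt)
open import Data.Sum using (_⊎_; inj₁; inj₂)
open import Data.List using (List; map; allFin; foldr)
open import Data.Nat.ListAction using (sum)
open import Data.Fin.Permutation using (Permutation′; _⟨$⟩ʳ_)
open import Relation.Binary.PropositionalEquality using (_≡_; refl)

record Graph (n : ℕ) : Set where
  field
    adj    : Fin n → Fin n → Bool
    sym    : ∀ i j → adj i j ≡ adj j i
    irrefl : ∀ i → adj i i ≡ false
open Graph public

count : ∀ {n} → (Fin n → Bool) → ℕ
count {n} p = sum (map (λ v → if p v then 1 else 0) (allFin n))

deg : ∀ {n} → Graph n → Fin n → ℕ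
deg G v = count (adj G v)

-- maximal degree Δ (0 for the empty graph)
maxDeg : ∀ {n} → Graph n → ℕ
maxDeg {n} G = foldr _⊔_ 0 (map (deg G) (allFin n))

isSep : ∀ {n} → Graph n → Fin n → Bool
isSep {n} G v = foldr (λ b c → b Data.Bool.∨ c) false
  (map (λ w → adj G v w ∧ (deg G v <ᵇ deg G w)) (allFin n))

sepCount : ∀ {n} → Graph n → ℕ
sepCount G = count (isSep G)

unionAdj : ∀ {a b} → Graph a → Graph b → Fin (a + b) → Fin (a + b) → Bool
unionAdj {a} G H i j with splitAt a i | splitAt a j
... | inj₁ x | inj₁ y = adj G x y
... | inj₂ x | inj₂ y = adj H x y
... | inj₁ _ | inj₂ _ = false
... | inj₂ _ | inj₁ _ = false

unionSym : ∀ {a b} (G : Graph a) (H : Graph b) i j → unionAdj G H i j ≡ unionAdj G H j i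
unionSym {a} G H i j with splitAt a i | splitAt a j
... | inj₁ x | inj₁ y = sym G x y
... | inj₂ x | inj₂ y = sym H x y
... | inj₁ _ | inj₂ _ = refl
... | inj₂ _ | inj₁ _ = refl

unionIrrefl : ∀ {a b} (G : Graph a) (H : Graph b) i → unionAdj G H i i ≡ false
unionIrrefl {a} G H i with splitAt a i
... | inj₁ x = irrefl G x
... | inj₂ x = irrefl H x

_⊕_ : ∀ {a b} → Graph a → Graph b → Graph (a + b)
G ⊕ H = record { adj = unionAdj G H ; sym = unionSym G H ; irrefl = unionIrrefl G H }

-- Σ_{i,j} |A(G)_{ij} - A(H)_{π(i)π(j)}|
diffSum : ∀ {n} → Graph n → Graph n → Permutation′ n → ℕ
diffSum {n} G H π = sum (map (λ i → count (λ j →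
  adj G i j xor adj H (π ⟨$⟩ʳ i) (π ⟨$⟩ʳ j))) (allFin n))

-- d(G,H) ≤ m  iff  some permutation π achieves (1/2)·diffSum ≤ m
-- (this is exactly "min over π of (1/2)·diffSum is ≤ m")
DistLe : ∀ {n} → Graph n → Graph n → ℕ → Set
DistLe {n} G H m = Data.Product.Σ (Permutation′ n) (λ π → diffSum G H π / 2 Data.Nat.≤ m)
  where import Data.Product

{-# OPTIONS --safe #-}
-- Let Δ be the maximum degree. Start from R₀ = (vertices of degree Δ) ∪ (separation vertices)
-- and repeatedly discard every vertex of R that neither has degree Δ nor has a neighbour in R
-- with more neighbours in R. Every vertex of degree Δ survives together with all its neighbours,
-- so the limit `core` splits G into G_Δ = G[core] and G₋ = G[V ∖ core], at distance the number
-- of core–complement edges. A core vertex of degree < Δ survived because of a richer neighbour,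
-- which gives (1); it is a separation vertex of G, and since it keeps an edge inside core it loses
-- at most Δ − 2 edges, which gives (5). A separation vertex of G₋ either is one of G or has lost
-- an edge to core, which gives (4); (2) and (3) follow from degree-Δ vertices staying in core.
module Submission where

open import Defs hiding (sym)
open import Data.Nat.Properties
open import Algebra.Properties.CommutativeSemigroup *-commutativeSemigroup using (x∙yz≈y∙xz)
open import Algebra.Properties.Semiring.Sum +-*-semiring
  using (sum; sum-syntax; sum-cong-≗; sum-replicate-zero; ∑-distrib-+; ∑-comm; ∑-permute; *-distribˡ-sum; *-distribʳ-sum)
open import Data.Bool using (Bool; true; false; _∧_; _∨_; not; _xor_; if_then_else_)
open import Data.Bool.Properties using (T-≡; ∧-identityʳ; ∧-zeroʳ) renaming (_≟_ to _≟ᵇ_)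
open import Data.Empty using (⊥-elim)
open import Data.Fin using (Fin; zero; suc; splitAt; join)
open import Data.Fin.Permutation using (Permutation; permutation; flip; _⟨$⟩ʳ_)
open import Data.Fin.Properties using (all?; ¬∀⟶∃¬; splitAt-join; join-splitAt)
import Data.List as List
open import Data.List.Properties using (map-tabulate)
open import Data.Nat using (ℕ; zero; suc; _+_; _*_; _∸_; _≤_; _<_; z≤n; s≤s; _<ᵇ_; _⊔_; _≤?_; _/_)
open import Data.Nat.DivMod using (m*n/n≡m)
open import Data.Product using (Σ; ∃-syntax; _×_; _,_; proj₁; proj₂)
open import Data.Sum using (_⊎_; inj₁; inj₂; [_,_]′; map₁; map₂)
open import Data.Sum.Properties using ([,]-∘; [,]-map)
import Data.Vec.Functional as Vec
open import Data.Vec.Functional using (_++_)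
open import Function using (_∘_; id; _$_; Equivalence)
open import Relation.Nullary using (yes; no; ¬_; does)
open import Relation.Nullary.Decidable using (dec-true; dec-false)
open import Relation.Binary.PropositionalEquality

χ : Bool → ℕ
χ b = if b then 1 else 0

true⇒≢false : ∀ {b} → b ≡ true → b ≢ false
true⇒≢false refl ()

<ᵇ⇒<′ : ∀ {m k} → (m <ᵇ k) ≡ true → m < k
<ᵇ⇒<′ {m} {k} m<ᵇk = <ᵇ⇒< m k (Equivalence.from T-≡ m<ᵇk)

<⇒<ᵇ′ : ∀ {m k} → m < k → (m <ᵇ k) ≡ true
<⇒<ᵇ′ = Equivalence.to T-≡ ∘ <⇒<ᵇ

∧-true : ∀ {x y} → x ∧ y ≡ true → x ≡ true × y ≡ true
∧-true {true} {true} _ = refl , refl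

χ-mono : ∀ {a b} → (a ≡ true → b ≡ true) → χ a ≤ χ b
χ-mono {false} _   = z≤n
χ-mono {true}  a⇒b rewrite a⇒b refl = ≤-refl

χ-mono-< : ∀ {a b} → (a ≡ true → b ≡ true) → a ≢ b → χ a < χ b
χ-mono-< {true}  a⇒b a≢b = ⊥-elim (a≢b (sym (a⇒b refl)))
χ-mono-< {false} {true}  _ _   = s≤s z≤n
χ-mono-< {false} {false} _ a≢b = ⊥-elim (a≢b refl)

χ*-mono : ∀ {r x y} → (r ≡ true → x ≤ y) → χ r * x ≤ χ r * y
χ*-mono {false} _   = z≤n
χ*-mono {true}  x≤y = *-monoʳ-≤ 1 (x≤y refl)

χ*≤ : ∀ r x → χ r * x ≤ x
χ*≤ false x = z≤n
χ*≤ true  x = ≤-reflexive (*-identityˡ x)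

foldr-map-allFin : ∀ {A B : Set} (_∙_ : A → B → B) (e : B) {n} (f : Fin n → A) →
                   List.foldr _∙_ e (List.map f (List.allFin n)) ≡ Vec.foldr _∙_ e f
foldr-map-allFin {A} _∙_ e f = trans (cong (List.foldr _∙_ e) (map-tabulate id f)) (foldr-tabulate f)
  where
  foldr-tabulate : ∀ {n} (g : Fin n → A) → List.foldr _∙_ e (List.tabulate g) ≡ Vec.foldr _∙_ e g
  foldr-tabulate {zero}  g = refl
  foldr-tabulate {suc n} g = cong (g zero ∙_) (foldr-tabulate (g ∘ suc))

count≡∑ : ∀ {n} (p : Fin n → Bool) → count p ≡ ∑[ v < n ] χ (p v)
count≡∑ p = foldr-map-allFin _+_ 0 (χ ∘ p)

anyᵇ : ∀ {n} → (Fin n → Bool) → Bool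
anyᵇ = Vec.foldr _∨_ false

anyᵇ-intro : ∀ {n} (f : Fin n → Bool) w → f w ≡ true → anyᵇ f ≡ true
anyᵇ-intro f zero    fw≡true rewrite fw≡true = refl
anyᵇ-intro f (suc w) fw≡true with f zero
... | true  = refl
... | false = anyᵇ-intro (f ∘ suc) w fw≡true

anyᵇ-elim : ∀ {n} (f : Fin n → Bool) → anyᵇ f ≡ true → ∃[ w ] f w ≡ true
anyᵇ-elim {suc n} f any≡true with f zero in f0≡true
... | true  = zero , f0≡true
... | false with anyᵇ-elim (f ∘ suc) any≡true
...   | w , fw≡true = suc w , fw≡true

∑-mono-≤ : ∀ {n} {f g : Fin n → ℕ} → (∀ i → f i ≤ g i) → sum f ≤ sum g
∑-mono-≤ {zero}  f≤g = z≤n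
∑-mono-≤ {suc n} f≤g = +-mono-≤ (f≤g zero) (∑-mono-≤ (f≤g ∘ suc))

∑-mono-< : ∀ {n} {f g : Fin n → ℕ} → (∀ i → f i ≤ g i) → ∀ w → f w < g w → sum f < sum g
∑-mono-< f≤g zero    fw<gw = +-mono-<-≤ fw<gw (∑-mono-≤ (f≤g ∘ suc))
∑-mono-< f≤g (suc w) fw<gw = +-mono-≤-< (f≤g zero) (∑-mono-< (f≤g ∘ suc) w fw<gw)

term≤∑ : ∀ {n} (f : Fin n → ℕ) w → f w ≤ sum f
term≤∑ f zero    = m≤m+n _ _
term≤∑ f (suc w) = ≤-trans (term≤∑ (f ∘ suc) w) (m≤n+m _ _)

∑χ-pos : ∀ {n} (p : Fin n → Bool) {v} → p v ≡ true → 1 ≤ ∑[ w < n ] χ (p w)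
∑χ-pos p {v} pv = ≤-trans (≤-reflexive (cong χ (sym pv))) (term≤∑ (χ ∘ p) v)

∑-zero : ∀ {n} {f : Fin n → ℕ} → (∀ i → f i ≡ 0) → sum f ≡ 0
∑-zero {n} f≡0 = trans (sum-cong-≗ f≡0) (sum-replicate-zero n)

∑-++ : ∀ {a b} (f : Fin a → ℕ) (g : Fin b → ℕ) → sum (f ++ g) ≡ sum f + sum g
∑-++ {zero}  f g = refl
∑-++ {suc a} f g = trans (cong (f zero +_) (trans (sum-cong-≗ (λ i → [,]-map (splitAt a i))) (∑-++ (f ∘ suc) g)))
                         (sym (+-assoc (f zero) _ _))

∑χ≤n : ∀ {n} (p : Fin n → Bool) → ∑[ v < n ] χ (p v) ≤ n
∑χ≤n {zero}  p = z≤n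
∑χ≤n {suc n} p = +-mono-≤ (χ≤1 (p zero)) (∑χ≤n (p ∘ suc))
  where
  χ≤1 : ∀ b → χ b ≤ 1
  χ≤1 true  = ≤-refl
  χ≤1 false = z≤n

record Partition {n} (R : Fin n → Bool) : Set where
  field
    a b            : ℕ
    outer          : Fin a → Fin n
    inner          : Fin b → Fin n
    classify       : Fin n → Fin a ⊎ Fin b
    classify-outer : ∀ x → classify (outer x) ≡ inj₁ x
    classify-inner : ∀ y → classify (inner y) ≡ inj₂ y
    embed-classify : ∀ v → [ outer , inner ]′ (classify v) ≡ v
    R-outer        : ∀ x → R (outer x) ≡ false
    R-inner        : ∀ y → R (inner y) ≡ true
    a+b≡n          : a + b ≡ n

module _ {n} (R : Fin (suc n) → Bool) (P : Partition (R ∘ suc)) where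
  open Partition P

  consInner : R zero ≡ true → Partition R
  consInner R0≡true = record
    { a = a ; b = suc b
    ; outer = suc ∘ outer
    ; inner = inner′
    ; classify = λ { zero → inj₂ zero ; (suc v) → map₂ suc (classify v) }
    ; classify-outer = λ x → cong (map₂ suc) (classify-outer x)
    ; classify-inner = λ { zero → refl ; (suc y) → cong (map₂ suc) (classify-inner y) }
    ; embed-classify = λ { zero → refl
                         ; (suc v) → trans ([,]-map (classify v))
                                       (trans (sym ([,]-∘ suc (classify v))) (cong suc (embed-classify v))) }
    ; R-outer = R-outer
    ; R-inner = λ { zero → R0≡true ; (suc y) → R-inner y }
    ; a+b≡n = trans (+-suc a b) (cong suc a+b≡n)
    }
    where
    inner′ : Fin (suc b) → Fin (suc n)
    inner′ zero    = zero
    inner′ (suc y) = suc (inner y)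

  consOuter : R zero ≡ false → Partition R
  consOuter R0≡false = record
    { a = suc a ; b = b
    ; outer = outer′
    ; inner = suc ∘ inner
    ; classify = λ { zero → inj₁ zero ; (suc v) → map₁ suc (classify v) }
    ; classify-outer = λ { zero → refl ; (suc x) → cong (map₁ suc) (classify-outer x) }
    ; classify-inner = λ y → cong (map₁ suc) (classify-inner y)
    ; embed-classify = λ { zero → refl
                         ; (suc v) → trans ([,]-map (classify v))
                                       (trans (sym ([,]-∘ suc (classify v))) (cong suc (embed-classify v))) }
    ; R-outer = λ { zero → R0≡false ; (suc x) → R-outer x }
    ; R-inner = R-inner
    ; a+b≡n = cong suc a+b≡n
    }
    where
    outer′ : Fin (suc a) → Fin (suc n)
    outer′ zero    = zero
    outer′ (suc x) = suc (outer x)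

partition : ∀ {n} (R : Fin n → Bool) → Partition R
partition {zero} R = record
  { a = 0 ; b = 0 ; outer = λ () ; inner = λ () ; classify = λ ()
  ; classify-outer = λ () ; classify-inner = λ () ; embed-classify = λ ()
  ; R-outer = λ () ; R-inner = λ () ; a+b≡n = refl }
partition {suc n} R with R zero in R0
... | true  = consInner R (partition (R ∘ suc)) R0
... | false = consOuter R (partition (R ∘ suc)) R0

module PartitionProperties {n} {R : Fin n → Bool} (P : Partition R) where
  open Partition P

  π : Permutation n (a + b)
  π = permutation (join a b ∘ classify) ([ outer , inner ]′ ∘ splitAt a)
        (λ k → trans (cong (join a b) (classify-embed (splitAt a k))) (join-splitAt a b k))
        (λ v → trans (cong [ outer , inner ]′ (splitAt-join a b (classify v))) (embed-classify v))
    where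
    classify-embed : ∀ s → classify ([ outer , inner ]′ s) ≡ s
    classify-embed (inj₁ x) = classify-outer x
    classify-embed (inj₂ y) = classify-inner y

  ∑-split : (g : Fin n → ℕ) → sum g ≡ sum (g ∘ outer) + sum (g ∘ inner)
  ∑-split g = begin
    sum g                                           ≡⟨ ∑-permute g (flip π) ⟩
    sum (g ∘ [ outer , inner ]′ ∘ splitAt a)        ≡⟨ sum-cong-≗ (λ k → [,]-∘ g (splitAt a k)) ⟩
    sum ((g ∘ outer) ++ (g ∘ inner))                ≡⟨ ∑-++ (g ∘ outer) (g ∘ inner) ⟩
    sum (g ∘ outer) + sum (g ∘ inner)               ∎
    where open ≡-Reasoning

  ∑-outer : (g : Fin n → ℕ) → sum (g ∘ outer) ≡ ∑[ v < n ] (χ (not (R v)) * g v)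
  ∑-outer g = sym $ begin
    ∑[ v < n ] (χ (not (R v)) * g v)                  ≡⟨ ∑-split (λ v → χ (not (R v)) * g v) ⟩
    ∑[ x < a ] (χ (not (R (outer x))) * g (outer x))
      + ∑[ y < b ] (χ (not (R (inner y))) * g (inner y))
      ≡⟨ cong₂ _+_ (sum-cong-≗ λ x → trans (cong (λ r → χ (not r) * g (outer x)) (R-outer x)) (*-identityˡ _))
                   (∑-zero λ y → cong (λ r → χ (not r) * g (inner y)) (R-inner y)) ⟩
    sum (g ∘ outer) + 0                             ≡⟨ +-identityʳ _ ⟩
    sum (g ∘ outer)                                 ∎
    where open ≡-Reasoning

  ∑-inner : (g : Fin n → ℕ) → sum (g ∘ inner) ≡ ∑[ v < n ] (χ (R v) * g v)
  ∑-inner g = sym $ begin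
    ∑[ v < n ] (χ (R v) * g v)                        ≡⟨ ∑-split (λ v → χ (R v) * g v) ⟩
    ∑[ x < a ] (χ (R (outer x)) * g (outer x)) + ∑[ y < b ] (χ (R (inner y)) * g (inner y))
      ≡⟨ cong₂ _+_ (∑-zero λ x → cong (λ r → χ r * g (outer x)) (R-outer x))
                   (sum-cong-≗ λ y → trans (cong (λ r → χ r * g (inner y)) (R-inner y)) (*-identityˡ _)) ⟩
    sum (g ∘ inner)                                 ∎
    where open ≡-Reasoning

  inner-surjective : ∀ v → R v ≡ true → ∃[ y ] inner y ≡ v
  inner-surjective v Rv≡true with classify v | embed-classify v
  ... | inj₁ x | refl = ⊥-elim (true⇒≢false Rv≡true (R-outer x))
  ... | inj₂ y | embed≡v = y , embed≡v

module _ {n} (G : Graph n) where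

  deg≡∑ : ∀ v → deg G v ≡ ∑[ w < n ] χ (adj G v w)
  deg≡∑ v = count≡∑ (adj G v)

  deg≤maxDeg : ∀ v → deg G v ≤ maxDeg G
  deg≤maxDeg v = subst (deg G v ≤_) (sym (foldr-map-allFin _⊔_ 0 (deg G))) (term≤max (deg G) v)
    where
    term≤max : ∀ {k} (f : Fin k → ℕ) w → f w ≤ Vec.foldr _⊔_ 0 f
    term≤max f zero    = m≤m⊔n _ _
    term≤max f (suc w) = ≤-trans (term≤max (f ∘ suc) w) (m≤n⊔m _ _)

  sepCount≡∑ : sepCount G ≡ ∑[ v < n ] χ (isSep G v)
  sepCount≡∑ = count≡∑ (isSep G)

  isSep≡anyᵇ : ∀ v → isSep G v ≡ anyᵇ (λ w → adj G v w ∧ (deg G v <ᵇ deg G w))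
  isSep≡anyᵇ v = foldr-map-allFin _∨_ false (λ w → adj G v w ∧ (deg G v <ᵇ deg G w))

  isSep-intro : ∀ {v w} → adj G v w ≡ true → deg G v < deg G w → isSep G v ≡ true
  isSep-intro {v} {w} vw dv<dw = trans (isSep≡anyᵇ v) (anyᵇ-intro _ w (cong₂ _∧_ vw (<⇒<ᵇ′ dv<dw)))

  isSep-elim : ∀ {v} → isSep G v ≡ true → ∃[ w ] adj G v w ≡ true × deg G v < deg G w
  isSep-elim {v} sep with anyᵇ-elim _ (trans (sym (isSep≡anyᵇ v)) sep)
  ... | w , vw∧dv<dw with ∧-true vw∧dv<dw
  ...   | vw , dv<dw = w , vw , <ᵇ⇒<′ dv<dw

  degIn : (Fin n → Bool) → Fin n → ℕ
  degIn R v = ∑[ w < n ] (χ (R w) * χ (adj G v w))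

  edgesBetween : (Fin n → Bool) → (Fin n → Bool) → ℕ
  edgesBetween R S = ∑[ v < n ] (χ (R v) * degIn S v)

  degIn+degIn-not : ∀ R v → degIn R v + degIn (not ∘ R) v ≡ deg G v
  degIn+degIn-not R v = begin
    degIn R v + degIn (not ∘ R) v
      ≡⟨ ∑-distrib-+ (λ w → χ (R w) * χ (adj G v w)) (λ w → χ (not (R w)) * χ (adj G v w)) ⟨
    ∑[ w < n ] (χ (R w) * χ (adj G v w) + χ (not (R w)) * χ (adj G v w))
      ≡⟨ sum-cong-≗ (λ w → split (R w) (adj G v w)) ⟩
    ∑[ w < n ] χ (adj G v w)
      ≡⟨ deg≡∑ v ⟨
    deg G v
      ∎
    where
    open ≡-Reasoning
    split : ∀ r e → χ r * χ e + χ (not r) * χ e ≡ χ e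
    split true  e = trans (+-identityʳ _) (*-identityˡ _)
    split false e = *-identityˡ _

  degIn≤deg : ∀ R v → degIn R v ≤ deg G v
  degIn≤deg R v = subst (degIn R v ≤_) (degIn+degIn-not R v) (m≤m+n _ _)

  degIn-full : ∀ {R v} → (∀ w → adj G v w ≡ true → R w ≡ true) → degIn R v ≡ deg G v
  degIn-full {R} {v} N⊆R = trans (sum-cong-≗ λ w → restrict (R w) (adj G v w) (N⊆R w)) (sym (deg≡∑ v))
    where
    restrict : ∀ r e → (e ≡ true → r ≡ true) → χ r * χ e ≡ χ e
    restrict true  e     _    = *-identityˡ _
    restrict false false _    = refl
    restrict false true  e⇒r  = ⊥-elim (true⇒≢false (e⇒r refl) refl)

  degIn-pos : ∀ {R v w} → R w ≡ true → adj G v w ≡ true → 1 ≤ degIn R v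
  degIn-pos {R} {v} {w} Rw vw =
    subst (_≤ degIn R v) (cong₂ (λ r e → χ r * χ e) Rw vw) (term≤∑ (λ u → χ (R u) * χ (adj G v u)) w)

  isSep⇒2≤maxDeg : ∀ {v} → isSep G v ≡ true → 2 ≤ maxDeg G
  isSep⇒2≤maxDeg {v} sep with isSep-elim sep
  ... | w , vw , dv<dw = ≤-trans (s≤s 1≤dv) (≤-trans dv<dw (deg≤maxDeg w))
    where
    1≤dv : 1 ≤ deg G v
    1≤dv = subst (1 ≤_) (sym (deg≡∑ v)) (∑χ-pos (adj G v) vw)

  edgesBetween-sym : ∀ R S → edgesBetween R S ≡ edgesBetween S R
  edgesBetween-sym R S = begin
    ∑[ v < n ] (χ (R v) * degIn S v)
      ≡⟨ sum-cong-≗ (λ v → *-distribˡ-sum (χ (R v)) (λ w → χ (S w) * χ (adj G v w))) ⟩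
    ∑[ v < n ] ∑[ w < n ] (χ (R v) * (χ (S w) * χ (adj G v w)))
      ≡⟨ ∑-comm (λ v w → χ (R v) * (χ (S w) * χ (adj G v w))) ⟩
    ∑[ w < n ] ∑[ v < n ] (χ (R v) * (χ (S w) * χ (adj G v w)))
      ≡⟨ sum-cong-≗ (λ w → sum-cong-≗ λ v → swap v w) ⟩
    ∑[ w < n ] ∑[ v < n ] (χ (S w) * (χ (R v) * χ (adj G w v)))
      ≡⟨ sum-cong-≗ (λ w → *-distribˡ-sum (χ (S w)) (λ v → χ (R v) * χ (adj G w v))) ⟨
    ∑[ w < n ] (χ (S w) * degIn R w)
      ∎
    where
    open ≡-Reasoning
    swap : ∀ v w → χ (R v) * (χ (S w) * χ (adj G v w)) ≡ χ (S w) * (χ (R v) * χ (adj G w v))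
    swap v w = trans (x∙yz≈y∙xz (χ (R v)) (χ (S w)) _) (cong (λ e → χ (S w) * (χ (R v) * χ e)) (Graph.sym G v w))

induced : ∀ {n m} → Graph n → (Fin m → Fin n) → Graph m
induced G e = record
  { adj = λ x y → adj G (e x) (e y) ; sym = λ x y → Graph.sym G (e x) (e y) ; irrefl = irrefl G ∘ e }

DistLe-via : ∀ {n m} (G : Graph n) (eq : m ≡ n) (H : Graph m) (π : Permutation n m) {c} →
             (∑[ i < n ] ∑[ j < n ] χ (adj G i j xor adj H (π ⟨$⟩ʳ i) (π ⟨$⟩ʳ j))) / 2 ≤ c →
             DistLe G (subst Graph eq H) c
DistLe-via {n} G refl H π {c} bound = π , subst (λ d → d / 2 ≤ c) (sym diffSum≡∑∑) bound
  where
  mismatch : Fin n → Fin n → Bool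
  mismatch i j = adj G i j xor adj H (π ⟨$⟩ʳ i) (π ⟨$⟩ʳ j)
  diffSum≡∑∑ : diffSum G H π ≡ ∑[ i < n ] ∑[ j < n ] χ (mismatch i j)
  diffSum≡∑∑ = trans (foldr-map-allFin _+_ 0 (count ∘ mismatch)) (sum-cong-≗ (count≡∑ ∘ mismatch))

module SplitGraph {n} (G : Graph n) {R : Fin n → Bool} (P : Partition R) where
  open Partition P
  open PartitionProperties P

  G₋ : Graph a
  G₋ = induced G outer

  GΔ : Graph b
  GΔ = induced G inner

  deg-outer : ∀ x → deg G₋ x ≡ degIn G (not ∘ R) (outer x)
  deg-outer x = trans (deg≡∑ G₋ x) (∑-outer (χ ∘ adj G (outer x)))

  deg-inner : ∀ y → deg GΔ y ≡ degIn G R (inner y)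
  deg-inner y = trans (deg≡∑ GΔ y) (∑-inner (χ ∘ adj G (inner y)))

  isSep-outer : ∀ x → χ (isSep G₋ x) ≤ χ (isSep G (outer x)) + degIn G R (outer x)
  isSep-outer x with isSep G₋ x in sep₀ | degIn G R (outer x) in d
  ... | false | _     = z≤n
  ... | true  | suc _ = ≤-trans (s≤s z≤n) (m≤n+m _ _)
  ... | true  | zero with isSep-elim G₋ sep₀
  ...   | z , xz , dx<dz = ≤-reflexive (cong (λ s → χ s + 0) (sym (isSep-intro G xz dx<dz′)))
    where
    deg₀≤deg : ∀ u → deg G₋ u ≤ deg G (outer u)
    deg₀≤deg u = subst (_≤ deg G (outer u)) (sym (deg-outer u)) (degIn≤deg G (not ∘ R) (outer u))
    dx≡d₀x : deg G (outer x) ≡ deg G₋ x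
    dx≡d₀x = trans (sym (degIn+degIn-not G R (outer x)))
                   (trans (cong (_+ degIn G (not ∘ R) (outer x)) d) (sym (deg-outer x)))
    dx<dz′ : deg G (outer x) < deg G (outer z)
    dx<dz′ = subst (_< deg G (outer z)) (sym dx≡d₀x) (<-≤-trans dx<dz (deg₀≤deg z))

  sepCount-outer≤ : sepCount G₋ ≤ ∑[ v < n ] (χ (not (R v)) * χ (isSep G v)) + edgesBetween G (not ∘ R) R
  sepCount-outer≤ = begin
    sepCount G₋
      ≡⟨ sepCount≡∑ G₋ ⟩
    ∑[ x < a ] χ (isSep G₋ x)
      ≤⟨ ∑-mono-≤ isSep-outer ⟩
    ∑[ x < a ] (χ (isSep G (outer x)) + degIn G R (outer x))
      ≡⟨ ∑-distrib-+ (χ ∘ isSep G ∘ outer) (degIn G R ∘ outer) ⟩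
    ∑[ x < a ] χ (isSep G (outer x)) + ∑[ x < a ] degIn G R (outer x)
      ≡⟨ cong₂ _+_ (∑-outer (χ ∘ isSep G)) (∑-outer (degIn G R)) ⟩
    ∑[ v < n ] (χ (not (R v)) * χ (isSep G v)) + edgesBetween G (not ∘ R) R
      ∎
    where open ≤-Reasoning

  union-adj : ∀ i j → adj (G₋ ⊕ GΔ) (π ⟨$⟩ʳ i) (π ⟨$⟩ʳ j) ≡ adj G i j ∧ not (R i xor R j)
  union-adj i j rewrite splitAt-join a b (classify i) | splitAt-join a b (classify j)
    with classify i | embed-classify i | classify j | embed-classify j
  ... | inj₁ x | refl | inj₁ y | refl rewrite R-outer x | R-outer y = sym (∧-identityʳ _)
  ... | inj₁ x | refl | inj₂ y | refl rewrite R-outer x | R-inner y = sym (∧-zeroʳ _)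
  ... | inj₂ x | refl | inj₁ y | refl rewrite R-inner x | R-outer y = sym (∧-zeroʳ _)
  ... | inj₂ x | refl | inj₂ y | refl rewrite R-inner x | R-inner y = sym (∧-identityʳ _)

  mismatches≡ : ∑[ i < n ] ∑[ j < n ] χ (adj G i j xor adj (G₋ ⊕ GΔ) (π ⟨$⟩ʳ i) (π ⟨$⟩ʳ j))
                ≡ edgesBetween G R (not ∘ R) * 2
  mismatches≡ = begin
    ∑[ i < n ] ∑[ j < n ] χ (adj G i j xor adj (G₋ ⊕ GΔ) (π ⟨$⟩ʳ i) (π ⟨$⟩ʳ j))
      ≡⟨ sum-cong-≗ (λ i → sum-cong-≗ λ j → cong (χ ∘ (adj G i j xor_)) (union-adj i j)) ⟩
    ∑[ i < n ] ∑[ j < n ] χ (adj G i j xor (adj G i j ∧ not (R i xor R j)))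
      ≡⟨ sum-cong-≗ row ⟩
    ∑[ i < n ] (χ (R i) * degIn G (not ∘ R) i + χ (not (R i)) * degIn G R i)
      ≡⟨ ∑-distrib-+ (λ i → χ (R i) * degIn G (not ∘ R) i) (λ i → χ (not (R i)) * degIn G R i) ⟩
    X + edgesBetween G (not ∘ R) R
      ≡⟨ cong (X +_) (edgesBetween-sym G (not ∘ R) R) ⟩
    X + X
      ≡⟨ cong (X +_) (+-identityʳ X) ⟨
    2 * X
      ≡⟨ *-comm 2 X ⟩
    X * 2
      ∎
    where
    open ≡-Reasoning
    X : ℕ
    X = edgesBetween G R (not ∘ R)
    crossing : ∀ r s e → χ (e xor (e ∧ not (r xor s))) ≡ χ r * (χ (not s) * χ e) + χ (not r) * (χ s * χ e)
    crossing true  true  true  = refl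
    crossing true  true  false = refl
    crossing true  false true  = refl
    crossing true  false false = refl
    crossing false true  true  = refl
    crossing false true  false = refl
    crossing false false true  = refl
    crossing false false false = refl
    row : ∀ i → ∑[ j < n ] χ (adj G i j xor (adj G i j ∧ not (R i xor R j)))
              ≡ χ (R i) * degIn G (not ∘ R) i + χ (not (R i)) * degIn G R i
    row i = begin
      ∑[ j < n ] χ (adj G i j xor (adj G i j ∧ not (R i xor R j)))
        ≡⟨ sum-cong-≗ (λ j → crossing (R i) (R j) (adj G i j)) ⟩
      ∑[ j < n ] (χ (R i) * (χ (not (R j)) * χ (adj G i j)) + χ (not (R i)) * (χ (R j) * χ (adj G i j)))
        ≡⟨ ∑-distrib-+ (λ j → χ (R i) * (χ (not (R j)) * χ (adj G i j)))
                       (λ j → χ (not (R i)) * (χ (R j) * χ (adj G i j))) ⟩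
      ∑[ j < n ] (χ (R i) * (χ (not (R j)) * χ (adj G i j)))
        + ∑[ j < n ] (χ (not (R i)) * (χ (R j) * χ (adj G i j)))
        ≡⟨ cong₂ _+_ (*-distribˡ-sum (χ (R i)) (λ j → χ (not (R j)) * χ (adj G i j)))
                     (*-distribˡ-sum (χ (not (R i))) (λ j → χ (R j) * χ (adj G i j))) ⟨
      χ (R i) * degIn G (not ∘ R) i + χ (not (R i)) * degIn G R i
        ∎

  distance≤ : ∀ {c} → edgesBetween G R (not ∘ R) ≤ c → DistLe G (subst Graph a+b≡n (G₋ ⊕ GΔ)) c
  distance≤ X≤c = DistLe-via G a+b≡n (G₋ ⊕ GΔ) π
    (≤-trans (≤-reflexive (trans (cong (_/ 2) mismatches≡) (m*n/n≡m _ 2))) X≤c)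

module Stabilise {n} (f : (Fin n → Bool) → Fin n → Bool)
                 (f-⊆ : ∀ R v → f R v ≡ true → R v ≡ true) where

  Stable : (Fin n → Bool) → Set
  Stable R = ∀ v → f R v ≡ R v

  stabilise : ℕ → (Fin n → Bool) → Fin n → Bool
  stabilise zero    R = R
  stabilise (suc m) R with all? (λ v → f R v ≟ᵇ R v)
  ... | yes _ = R
  ... | no  _ = stabilise m (f R)

  stabilise-preserves : (P : (Fin n → Bool) → Set) → (∀ {R} → P R → P (f R)) →
                        ∀ m R → P R → P (stabilise m R)
  stabilise-preserves P f-preserves zero    R PR = PR
  stabilise-preserves P f-preserves (suc m) R PR with all? (λ v → f R v ≟ᵇ R v)
  ... | yes _ = PR
  ... | no  _ = stabilise-preserves P f-preserves m (f R) (f-preserves PR)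

  stabilise-⊆ : ∀ m R v → stabilise m R v ≡ true → R v ≡ true
  stabilise-⊆ m R = stabilise-preserves (λ S → ∀ v → S v ≡ true → R v ≡ true)
                      (λ {S} S⊆R v → S⊆R v ∘ f-⊆ S v) m R (λ _ → id)

  unstable-shrinks : ∀ R → ¬ Stable R → ∑[ v < n ] χ (f R v) < ∑[ v < n ] χ (R v)
  unstable-shrinks R unstable with ¬∀⟶∃¬ n _ (λ v → f R v ≟ᵇ R v) unstable
  ... | w , fRw≢Rw = ∑-mono-< (λ v → χ-mono (f-⊆ R v)) w (χ-mono-< (f-⊆ R w) fRw≢Rw)

  stabilise-stable : ∀ m R → ∑[ v < n ] χ (R v) ≤ m → Stable (stabilise m R)
  stabilise-stable zero    R size≤0 v with R v in Rv
  ... | true  = ⊥-elim (1+n≰n (≤-trans (∑χ-pos R Rv) size≤0))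
  ... | false with f R v in fRv
  ...   | false = refl
  ...   | true  = ⊥-elim (true⇒≢false (f-⊆ R v fRv) Rv)
  stabilise-stable (suc m) R size≤m with all? (λ v → f R v ≟ᵇ R v)
  ... | yes stable   = stable
  ... | no  unstable = stabilise-stable m (f R) (≤-pred (<-≤-trans (unstable-shrinks R unstable) size≤m))

module Peeling {n} (G : Graph n) where

  Δ : ℕ
  Δ = maxDeg G

  isTop : Fin n → Bool
  isTop v = does (Δ ≤? deg G v)

  record KeepsTops (R : Fin n → Bool) : Set where
    field
      top∈     : ∀ {v} → Δ ≤ deg G v → R v ≡ true
      top-nbr∈ : ∀ {v w} → Δ ≤ deg G v → adj G v w ≡ true → R w ≡ true

    degIn-top : ∀ {v} → Δ ≤ deg G v → degIn G R v ≡ deg G v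
    degIn-top top = degIn-full G (λ w → top-nbr∈ top)

    degIn-not-top : ∀ {v} → Δ ≤ deg G v → degIn G (not ∘ R) v ≡ 0
    degIn-not-top {v} top = +-cancelˡ-≡ (deg G v) (degIn G (not ∘ R) v) 0 (begin
      deg G v + degIn G (not ∘ R) v          ≡⟨ cong (_+ degIn G (not ∘ R) v) (degIn-top top) ⟨
      degIn G R v + degIn G (not ∘ R) v      ≡⟨ degIn+degIn-not G R v ⟩
      deg G v                                ≡⟨ +-identityʳ (deg G v) ⟨
      deg G v + 0                            ∎)
      where open ≡-Reasoning
  open KeepsTops

  R₀ : Fin n → Bool
  R₀ v = isTop v ∨ isSep G v

  isTop-false : ∀ {v} → deg G v < Δ → isTop v ≡ false
  isTop-false {v} dv<Δ = dec-false (Δ ≤? deg G v) (<⇒≱ dv<Δ)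

  isSepIn : (Fin n → Bool) → Fin n → Bool
  isSepIn R v = anyᵇ (λ w → R w ∧ adj G v w ∧ (degIn G R v <ᵇ degIn G R w))

  isSepIn-elim : ∀ {R v} → isSepIn R v ≡ true →
                 ∃[ w ] R w ≡ true × adj G v w ≡ true × degIn G R v < degIn G R w
  isSepIn-elim sepIn with anyᵇ-elim _ sepIn
  ... | w , Rw∧vw∧in< with ∧-true Rw∧vw∧in<
  ...   | Rw , vw∧in< with ∧-true vw∧in<
  ...     | vw , in< = w , Rw , vw , <ᵇ⇒<′ in<

  peel : (Fin n → Bool) → Fin n → Bool
  peel R v = R v ∧ (isTop v ∨ isSepIn R v)

  peel-⊆ : ∀ R v → peel R v ≡ true → R v ≡ true
  peel-⊆ R v = proj₁ ∘ ∧-true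

  R₀-keepsTops : KeepsTops R₀
  R₀-keepsTops .top∈ {v} top = cong (_∨ isSep G v) (dec-true (Δ ≤? deg G v) top)
  R₀-keepsTops .top-nbr∈ {v} {w} top vw with Δ ≤? deg G w
  ... | yes dw≥Δ = cong (_∨ isSep G w) (dec-true (Δ ≤? deg G w) dw≥Δ)
  ... | no  dw≱Δ = trans (cong (_∨ isSep G w) (dec-false (Δ ≤? deg G w) dw≱Δ))
                         (isSep-intro G (trans (Graph.sym G w v) vw) (<-≤-trans (≰⇒> dw≱Δ) top))

  peel-keepsTops : ∀ {R} → KeepsTops R → KeepsTops (peel R)
  peel-keepsTops K .top∈ {v} top rewrite top∈ K top | dec-true (Δ ≤? deg G v) top = refl
  peel-keepsTops {R} K .top-nbr∈ {v} {w} top vw rewrite top-nbr∈ K top vw with Δ ≤? deg G w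
  ... | yes dw≥Δ rewrite dec-true (Δ ≤? deg G w) dw≥Δ = refl
  ... | no  dw≱Δ rewrite dec-false (Δ ≤? deg G w) dw≱Δ =
    anyᵇ-intro (λ u → R u ∧ adj G w u ∧ (degIn G R w <ᵇ degIn G R u)) v
      (cong₂ _∧_ (top∈ K top) (cong₂ _∧_ wv (<⇒<ᵇ′ inw<inv)))
    where
    wv : adj G w v ≡ true
    wv = trans (Graph.sym G w v) vw
    inw<inv : degIn G R w < degIn G R v
    inw<inv = begin-strict
      degIn G R w  ≤⟨ degIn≤deg G R w ⟩
      deg G w      <⟨ ≰⇒> dw≱Δ ⟩
      Δ            ≤⟨ top ⟩
      deg G v      ≡⟨ degIn-top K top ⟨
      degIn G R v  ∎
      where open ≤-Reasoning

  open Stabilise peel peel-⊆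

  core : Fin n → Bool
  core = stabilise n R₀

  core-keepsTops : KeepsTops core
  core-keepsTops = stabilise-preserves KeepsTops peel-keepsTops n R₀ R₀-keepsTops

  core⊆R₀ : ∀ v → core v ≡ true → R₀ v ≡ true
  core⊆R₀ = stabilise-⊆ n R₀

  core-stable : Stable core
  core-stable = stabilise-stable n R₀ (∑χ≤n R₀)

  core-low : ∀ {v} → core v ≡ true → deg G v < Δ →
             isSep G v ≡ true × ∃[ w ] core w ≡ true × adj G v w ≡ true × degIn G core v < degIn G core w
  core-low {v} cv dv<Δ =
    below (core⊆R₀ v cv) , isSepIn-elim (below (proj₂ (∧-true (trans (core-stable v) cv))))
    where
    below : ∀ {b} → isTop v ∨ b ≡ true → b ≡ true
    below {b} = trans (cong (_∨ b) (sym (isTop-false dv<Δ)))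

  degIn-not-core≤ : ∀ {v} → core v ≡ true → degIn G (not ∘ core) v ≤ χ (isSep G v) * (Δ ∸ 2)
  degIn-not-core≤ {v} cv with Δ ≤? deg G v
  ... | yes top = ≤-trans (≤-reflexive (degIn-not-top core-keepsTops top)) z≤n
  ... | no ¬top with core-low cv (≰⇒> ¬top)
  ...   | sep , w , cw , vw , _ rewrite sep =
    subst (out ≤_) (sym (*-identityˡ (Δ ∸ 2))) (m+n≤o⇒m≤o∸n out out+2≤Δ)
    where
    out : ℕ
    out = degIn G (not ∘ core) v
    out+2≤Δ : out + 2 ≤ Δ
    out+2≤Δ = begin
      out + 2                        ≡⟨ +-suc out 1 ⟩
      suc (out + 1)                  ≤⟨ s≤s (+-monoʳ-≤ out (degIn-pos G {R = core} cw vw)) ⟩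
      suc (out + degIn G core v)     ≡⟨ cong suc (+-comm out (degIn G core v)) ⟩
      suc (degIn G core v + out)     ≡⟨ cong suc (degIn+degIn-not G core v) ⟩
      suc (deg G v)                  ≤⟨ ≰⇒> ¬top ⟩
      Δ                              ∎
      where open ≤-Reasoning

  edgesBetween-core≤ : edgesBetween G core (not ∘ core)
                       ≤ ∑[ v < n ] (χ (core v) * (χ (isSep G v) * (Δ ∸ 2)))
  edgesBetween-core≤ = ∑-mono-≤ λ v → χ*-mono (degIn-not-core≤ {v})

  edgesBetween-core≤sepCount : edgesBetween G core (not ∘ core) ≤ sepCount G * (Δ ∸ 2)
  edgesBetween-core≤sepCount = begin
    edgesBetween G core (not ∘ core)                        ≤⟨ edgesBetween-core≤ ⟩
    ∑[ v < n ] (χ (core v) * (χ (isSep G v) * (Δ ∸ 2)))     ≤⟨ ∑-mono-≤ (λ v → χ*≤ (core v) _) ⟩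
    ∑[ v < n ] (χ (isSep G v) * (Δ ∸ 2))                    ≡⟨ *-distribʳ-sum (Δ ∸ 2) (χ ∘ isSep G) ⟨
    ∑[ v < n ] χ (isSep G v) * (Δ ∸ 2)                      ≡⟨ cong (_* (Δ ∸ 2)) (sepCount≡∑ G) ⟨
    sepCount G * (Δ ∸ 2)                                    ∎
    where open ≤-Reasoning

  P : Partition core
  P = partition core
  open Partition P
  open PartitionProperties P
  open SplitGraph G P

  deg-inner-top : ∀ {y} → Δ ≤ deg G (inner y) → deg GΔ y ≡ deg G (inner y)
  deg-inner-top {y} top = trans (deg-inner y) (degIn-top core-keepsTops top)

  deg-GΔ≤deg : ∀ y → deg GΔ y ≤ deg G (inner y)
  deg-GΔ≤deg y = subst (_≤ deg G (inner y)) (sym (deg-inner y)) (degIn≤deg G core (inner y))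

  deg-GΔ<Δ⇒deg<Δ : ∀ {y} → deg GΔ y < Δ → deg G (inner y) < Δ
  deg-GΔ<Δ⇒deg<Δ low = ≰⇒> λ top → <⇒≱ low (subst (Δ ≤_) (sym (deg-inner-top top)) top)

  GΔ-low⇒isSep : ∀ y → deg GΔ y < Δ → isSep GΔ y ≡ true
  GΔ-low⇒isSep y low with core-low (R-inner y) (deg-GΔ<Δ⇒deg<Δ low)
  ... | _ , w , cw , yw , in< with inner-surjective w cw
  ...   | z , refl = isSep-intro GΔ yw (subst₂ _<_ (sym (deg-inner y)) (sym (deg-inner z)) in<)

  isSep-GΔ⇒isSep : ∀ y → isSep GΔ y ≡ true → isSep G (inner y) ≡ true
  isSep-GΔ⇒isSep y sep with Δ ≤? deg G (inner y)
  ... | no ¬top = proj₁ (core-low (R-inner y) (≰⇒> ¬top))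
  ... | yes top with isSep-elim GΔ sep
  ...   | z , _ , dy<dz = ⊥-elim (<⇒≱ dy<dz (begin
    deg GΔ z          ≤⟨ deg-GΔ≤deg z ⟩
    deg G (inner z)   ≤⟨ deg≤maxDeg G (inner z) ⟩
    Δ                 ≤⟨ top ⟩
    deg G (inner y)   ≡⟨ deg-inner-top top ⟨
    deg GΔ y          ∎))
    where open ≤-Reasoning

  sepCount-GΔ≤ : sepCount GΔ ≤ sepCount G
  sepCount-GΔ≤ = begin
    sepCount GΔ                                 ≡⟨ sepCount≡∑ GΔ ⟩
    ∑[ y < b ] χ (isSep GΔ y)                   ≤⟨ ∑-mono-≤ (λ y → χ-mono (isSep-GΔ⇒isSep y)) ⟩
    ∑[ y < b ] χ (isSep G (inner y))            ≡⟨ ∑-inner (χ ∘ isSep G) ⟩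
    ∑[ v < n ] (χ (core v) * χ (isSep G v))     ≤⟨ ∑-mono-≤ (λ v → χ*≤ (core v) _) ⟩
    ∑[ v < n ] χ (isSep G v)                    ≡⟨ sepCount≡∑ G ⟨
    sepCount G                                  ∎
    where open ≤-Reasoning

  deg-G₋<Δ : ∀ x → deg G₋ x < Δ
  deg-G₋<Δ x = begin-strict
    deg G₋ x                        ≡⟨ deg-outer x ⟩
    degIn G (not ∘ core) (outer x)  ≤⟨ degIn≤deg G (not ∘ core) (outer x) ⟩
    deg G (outer x)                 <⟨ ≰⇒> (λ top → true⇒≢false (top∈ core-keepsTops top) (R-outer x)) ⟩
    Δ                               ∎
    where open ≤-Reasoning

  sepCount-G₋≤ : sepCount G₋ ≤ sepCount G * (Δ ∸ 1)
  sepCount-G₋≤ = begin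
    sepCount G₋
      ≤⟨ sepCount-outer≤ ⟩
    outerSeps + edgesBetween G (not ∘ core) core
      ≡⟨ cong (outerSeps +_) (edgesBetween-sym G (not ∘ core) core) ⟩
    outerSeps + edgesBetween G core (not ∘ core)
      ≤⟨ +-monoʳ-≤ outerSeps edgesBetween-core≤ ⟩
    outerSeps + ∑[ v < n ] (χ (core v) * (χ (isSep G v) * (Δ ∸ 2)))
      ≡⟨ ∑-distrib-+ (λ v → χ (not (core v)) * χ (isSep G v)) (λ v → χ (core v) * (χ (isSep G v) * (Δ ∸ 2))) ⟨
    ∑[ v < n ] (χ (not (core v)) * χ (isSep G v) + χ (core v) * (χ (isSep G v) * (Δ ∸ 2)))
      ≤⟨ ∑-mono-≤ (λ v → mix (core v) (isSep G v) (isSep⇒2≤maxDeg G)) ⟩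
    ∑[ v < n ] (χ (isSep G v) * (Δ ∸ 1))
      ≡⟨ *-distribʳ-sum (Δ ∸ 1) (χ ∘ isSep G) ⟨
    ∑[ v < n ] χ (isSep G v) * (Δ ∸ 1)
      ≡⟨ cong (_* (Δ ∸ 1)) (sepCount≡∑ G) ⟨
    sepCount G * (Δ ∸ 1)
      ∎
    where
    open ≤-Reasoning
    outerSeps : ℕ
    outerSeps = ∑[ v < n ] (χ (not (core v)) * χ (isSep G v))
    mix : ∀ c s → (s ≡ true → 2 ≤ Δ) → χ (not c) * χ s + χ c * (χ s * (Δ ∸ 2)) ≤ χ s * (Δ ∸ 1)
    mix c     false _   = ≤-reflexive (cong₂ _+_ (*-zeroʳ (χ (not c))) (*-zeroʳ (χ c)))
    mix true  true  _   = ≤-trans (≤-reflexive (+-identityʳ _)) (*-monoʳ-≤ 1 (∸-monoʳ-≤ Δ (n≤1+n 1)))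
    mix false true  2≤Δ = ≤-trans (m+n≤o⇒m≤o∸n 1 (2≤Δ refl)) (m≤m+n _ 0)

lemma3 : ∀ {n} (G : Graph n) →
    Σ ℕ λ a → Σ ℕ λ b → Σ (a + b ≡ n) λ eq →
    Σ (Graph a) λ Gm → Σ (Graph b) λ GΔ →
      ((v : Fin b) → deg GΔ v < maxDeg G → isSep GΔ v ≡ true)
      × sepCount GΔ ≤ sepCount G
      × ((v : Fin a) → deg Gm v < maxDeg G)
      × sepCount Gm ≤ sepCount G * (maxDeg G ∸ 1)
      × DistLe G (subst Graph eq (Gm ⊕ GΔ)) (sepCount G * (maxDeg G ∸ 2))
lemma3 G =
  a , b , a+b≡n , G₋ , GΔ ,
  GΔ-low⇒isSep , sepCount-GΔ≤ , deg-G₋<Δ , sepCount-G₋≤ ,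
  distance≤ edgesBetween-core≤sepCount
  where
  open Peeling G
  open Partition P using (a; b; a+b≡n)
  open SplitGraph G P using (G₋; GΔ; distance≤)
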